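{- Let $k\in\mathbb{N}$, let $\mathbf{X},\mathbf{A}$ be two finite $k$-enhanced $\sigma$-structures, and let $\xi:\mathbf{X}^{\otimes k}\to\mathbb{F}_{\mathscr{Q}_{\mathrm{conv}}}(\mathbf{A}^{\otimes k})$ be a homomorphism. Then $\xi(\mathbf{x})(\mathbf{a})=0$ for all $\mathbf{x}\in X^k$ and $\mathbf{a}\in A^k$ such that $\mathbf{x}\not\prec\mathbf{a}$.
   Context: A $\sigma$-structure $\mathbf{A}$ has domain $A$ and relations $R^{\mathbf{A}}\subseteq A^{\mathrm{ar}(R)}$; homomorphisms preserve all relations coordinatewise. For $\mathbf{x}=(x_1,\dots,x_k)$ and $\mathbf{i}=(i_1,\dots,i_\ell)\in[k]^\ell$, $\mathbf{x}_{\mathbf{i}}=(x_{i_1},\dots,x_{i_\ell})$. For tuples $\mathbf{s}\in S^k$, $\mathbf{t}\in T^k$, $\mathbf{s}\prec\mathbf{t}$ means that $s_\alpha=s_\beta$ implies $t_\alpha=t_\beta$ for all $\alpha,\beta\in[k]$; $\not\prec$ is its negation. A $\sigma$-structure is $k$-enhanced if $\sigma$ contains a $k$-ary symbol $R_k$ with $R_k^{\mathbf{A}}=A^k$. Tensor power: $\mathbf{A}^{\otimes k}$ has the same symbols, where $R$ of arity $r$ gets arity $r^k$ with positions indexed by $[r]^k$; domain $A^k$; $R^{\mathbf{A}^{\otimes k}}=\{\mathbf{a}^{\otimes k}:\mathbf{a}\in R^{\mathbf{A}}\}$ with $\mathbf{a}^{\otimes k}$ the family whose $\mathbf{i}$-th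 entry is $\mathbf{a}_{\mathbf{i}}\in A^k$. Maps are applied to such families entrywise. $\mathbb{F}_{\mathscr{Q}_{\mathrm{conv}}}(\mathbf{A}^{\otimes k})$: domain is the set of nonnegative rational tensors indexed by $A^k$ with entries summing to $1$ ($T(\mathbf{a})$ is the $\mathbf{a}$-entry); a family $(M_{\mathbf{i}})_{\mathbf{i}\in[r]^k}$ is in $R^{\mathbb{F}_{\mathscr{Q}_{\mathrm{conv}}}(\mathbf{A}^{\otimes k})}$ iff there is a rational probability vector $q$ on $R^{\mathbf{A}}$ with $M_{\mathbf{i}}(\mathbf{a})=\sum_{\mathbf{b}\in R^{\mathbf{A}},\,\mathbf{b}_{\mathbf{i}}=\mathbf{a}}q(\mathbf{b})$ for all $\mathbf{i}\in[r]^k$, $\mathbf{a}\in A^k$. -}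

module Defs where

open import Data.Nat using (ℕ; zero; suc)
open import Data.Fin using (Fin)
open import Data.Vec using (Vec; []; _∷_; lookup; map)
open import Data.Vec.Properties using (≡-dec)
open import Data.Fin.Properties using (_≟_)
open import Data.List using (List; [_]; concatMap; allFin; foldr)
import Data.List as L
open import Data.Rational using (ℚ; 0ℚ; 1ℚ; _+_; _≤_)
open import Data.Product using (Σ; Σ-syntax; ∃; ∃-syntax; _×_; proj₁)
open import Relation.Binary.PropositionalEquality using (_≡_; _≢_)
open import Relation.Nullary using (¬_; yes; no)

record Signature : Set₁ where
  field
    Sym : Set
    ar  : Sym → ℕ
open Signature public

record Structure (σ : Signature) : Set₁ where
  field
    size : ℕ
    rel  : (R : Sym σ) → Vec (Fin size) (ar σ R) → Set
open Structure public

Dom : ∀ {σ} → Structure σ → Set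
Dom A = Fin (size A)

Enhanced : ∀ {σ} → ℕ → Structure σ → Set
Enhanced {σ} k A = Σ[ R ∈ Sym σ ] Σ[ p ∈ ar σ R ≡ k ] (∀ (t : Vec (Dom A) (ar σ R)) → rel A R t)

-- x_i = (x_{i_1}, …, x_{i_ℓ})
select : ∀ {S : Set} {k ℓ} → Vec S k → Vec (Fin k) ℓ → Vec S ℓ
select x i = map (lookup x) i

_≺_ : ∀ {S T : Set} {k} → Vec S k → Vec T k → Set
s ≺ t = ∀ α β → lookup s α ≡ lookup s β → lookup t α ≡ lookup t β

allVecs : (n r : ℕ) → List (Vec (Fin n) r)
allVecs n zero = [ [] ]
allVecs n (suc r) = concatMap (λ c → L.map (c ∷_) (allVecs n r)) (allFin n)

sumℚ : ∀ {S : Set} → (S → ℚ) → List S → ℚ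
sumℚ f = foldr (λ s acc → f s + acc) 0ℚ

Σall : ∀ {n r} → (Vec (Fin n) r → ℚ) → ℚ
Σall {n} {r} f = sumℚ f (allVecs n r)

-- Domain of F_{Q_conv}(A^{⊗k}): nonnegative rational tensors indexed by A^k summing to 1.
Tensor : ℕ → ℕ → Set
Tensor n k = Σ[ T ∈ (Vec (Fin n) k → ℚ) ] ((∀ a → 0ℚ ≤ T a) × Σall T ≡ 1ℚ)

marginal : ∀ {n r k} → (Vec (Fin n) r → ℚ) → Vec (Fin r) k → Vec (Fin n) k → ℚ
marginal q i a = Σall (λ b → ifEq (≡-dec _≟_ (select b i) a) (q b))
  where
  ifEq : ∀ {P : Set} → Relation.Nullary.Dec P → ℚ → ℚ
  ifEq (yes _) v = v
  ifEq (no _)  _ = 0ℚ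

-- R^{F_{Q_conv}(A^{⊗k})}: families (M_i)_{i ∈ [r]^k} of tensors
FreeRel : ∀ {σ} (A : Structure σ) (k : ℕ) (R : Sym σ) →
          (Vec (Fin (ar σ R)) k → Tensor (size A) k) → Set
FreeRel {σ} A k R M =
  Σ[ q ∈ (Vec (Dom A) (ar σ R) → ℚ) ]
    ( (∀ b → 0ℚ ≤ q b)
    × (∀ b → q b ≢ 0ℚ → rel A R b)
    × Σall q ≡ 1ℚ
    × (∀ i a → proj₁ (M i) a ≡ marginal q i a))

-- R^{X^{⊗k}}: families (x_i)_{i ∈ [r]^k} equal to x^{⊗k} for some x ∈ R^X
TensorRel : ∀ {σ} (X : Structure σ) (k : ℕ) (R : Sym σ) →
            (Vec (Fin (ar σ R)) k → Vec (Dom X) k) → Set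
TensorRel {σ} X k R F =
  Σ[ x ∈ Vec (Dom X) (ar σ R) ] (rel X R x × (∀ i → F i ≡ select x i))

IsHomTensorFree : ∀ {σ} (k : ℕ) (X A : Structure σ) →
                  (Vec (Dom X) k → Tensor (size A) k) → Set
IsHomTensorFree {σ} k X A ξ =
  ∀ (R : Sym σ) (F : Vec (Fin (ar σ R)) k → Vec (Dom X) k) →
    TensorRel X k R F → FreeRel A k R (λ i → ξ (F i))

{-# OPTIONS --safe #-}
module Submission where

-- If x ⊀ a, pick α, β with x_α = x_β but a_α ≠ a_β, and an index tuple i with
-- i_α = i_β and x_i = x (send β to α). Since X is k-enhanced, x ∈ R_k^X, so
-- (x_j)_j lies in R_k^{X^{⊗k}} and ξ(x) = ξ(x_i) is the i-th marginal of a
-- distribution q on A^k. Every b with b_i = a would have a_α = b_{i_α} = b_{i_β} = a_β,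
-- so that marginal is an empty sum.

open import Defs
open import Data.Empty using (⊥-elim)
open import Data.Fin using (Fin)
open import Data.Fin.Properties using (¬∀⟶∃¬; all?) renaming (_≟_ to _≟ᶠ_)
open import Data.List using (List; []; _∷_; foldr)
open import Data.Nat using (ℕ)
open import Data.Product using (Σ-syntax; _×_; _,_; proj₁)
open import Data.Rational using (ℚ; 0ℚ)
open import Data.Vec using (Vec; lookup; tabulate)
open import Data.Vec.Properties using (≡-dec; lookup-map; lookup∘tabulate; tabulate∘lookup; tabulate-cong)
open import Relation.Binary.Definitions using (DecidableEquality)
open import Relation.Binary.PropositionalEquality using (_≡_; _≢_; refl; sym; trans; cong; subst; module ≡-Reasoning)
open import Relation.Nullary using (¬_; Dec; yes; no)
open import Relation.Nullary.Decidable using (_→-dec_)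

foldr-fixedPoint : ∀ {A B : Set} (g : A → B → B) {z : B} →
                   (∀ a → g a z ≡ z) → (l : List A) → foldr g z l ≡ z
foldr-fixedPoint g fixed []      = refl
foldr-fixedPoint g fixed (a ∷ l) = trans (cong (g a) (foldr-fixedPoint g fixed l)) (fixed a)

-- Defs keeps the summand of `marginal` local; unifying against its unfolding recovers the fold step.
stepOf : ∀ {n r} {g : Vec (Fin n) r → ℚ → ℚ} (s : ℚ) →
         s ≡ foldr g 0ℚ (allVecs n r) → Vec (Fin n) r → ℚ → ℚ
stepOf {g = g} _ _ = g

marginalStep : ∀ {n r k} → (Vec (Fin n) r → ℚ) → Vec (Fin r) k → Vec (Fin n) k → Vec (Fin n) r → ℚ → ℚ
marginalStep q i a = stepOf (marginal q i a) refl

marginalStep-fixes-0 : ∀ {n r k} (q : Vec (Fin n) r → ℚ) (i : Vec (Fin r) k) (a : Vec (Fin n) k) b →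
                       select b i ≢ a → marginalStep q i a b 0ℚ ≡ 0ℚ
marginalStep-fixes-0 q i a b bᵢ≢a with ≡-dec _≟ᶠ_ (select b i) a
... | yes bᵢ≡a = ⊥-elim (bᵢ≢a bᵢ≡a)
... | no _     = refl

marginal-≡0 : ∀ {n r k} (q : Vec (Fin n) r → ℚ) (i : Vec (Fin r) k) (a : Vec (Fin n) k) →
              (∀ b → select b i ≢ a) → marginal q i a ≡ 0ℚ
marginal-≡0 {n} {r} q i a unreachable =
  foldr-fixedPoint (marginalStep q i a) (λ b → marginalStep-fixes-0 q i a b (unreachable b)) (allVecs n r)

select-≢ : ∀ {S : Set} {r k} {i : Vec (Fin r) k} {a : Vec S k} {α β : Fin k} →
           lookup i α ≡ lookup i β → lookup a α ≢ lookup a β → ∀ b → select b i ≢ a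
select-≢ {i = i} {a} {α} {β} iα≡iβ aα≢aβ b bᵢ≡a = aα≢aβ (begin
  lookup a α               ≡⟨ cong (λ v → lookup v α) bᵢ≡a ⟨
  lookup (select b i) α    ≡⟨ lookup-map α (lookup b) i ⟩
  lookup b (lookup i α)    ≡⟨ cong (lookup b) iα≡iβ ⟩
  lookup b (lookup i β)    ≡⟨ lookup-map β (lookup b) i ⟨
  lookup (select b i) β    ≡⟨ cong (λ v → lookup v β) bᵢ≡a ⟩
  lookup a β               ∎)
  where open ≡-Reasoning

hom-≡0 : ∀ {σ k} {X A : Structure σ} (ξ : Vec (Dom X) k → Tensor (size A) k) →
         IsHomTensorFree k X A ξ → ∀ R {x : Vec (Dom X) (ar σ R)} → rel X R x →
         (i : Vec (Fin (ar σ R)) k) (a : Vec (Dom A) k) →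
         (∀ b → select b i ≢ a) → proj₁ (ξ (select x i)) a ≡ 0ℚ
hom-≡0 ξ hom R {x} x∈R i a unreachable with hom R (select x) (x , x∈R , λ _ → refl)
... | q , _ , _ , _ , ξ≡marginal = trans (ξ≡marginal i a) (marginal-≡0 q i a unreachable)

module _ {k : ℕ} (α β : Fin k) where

  redirect : Fin k → Fin k
  redirect j with j ≟ᶠ β
  ... | yes _ = α
  ... | no _  = j

  redirect-α≡redirect-β : redirect α ≡ redirect β
  redirect-α≡redirect-β with α ≟ᶠ β | β ≟ᶠ β
  ... | _     | no β≢β = ⊥-elim (β≢β refl)
  ... | yes _ | yes _  = refl
  ... | no _  | yes _  = refl

  lookup-redirect : ∀ {S : Set} (x : Vec S k) → lookup x α ≡ lookup x β →
                    ∀ j → lookup x (redirect j) ≡ lookup x j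
  lookup-redirect x xα≡xβ j with j ≟ᶠ β
  ... | yes refl = xα≡xβ
  ... | no _     = refl

  select-redirect : ∀ {S : Set} (x : Vec S k) → lookup x α ≡ lookup x β →
                    select x (tabulate redirect) ≡ x
  select-redirect x xα≡xβ = begin
    select x (tabulate redirect)                     ≡⟨ tabulate∘lookup _ ⟨
    tabulate (lookup (select x (tabulate redirect))) ≡⟨ tabulate-cong lookup-select ⟩
    tabulate (lookup x)                              ≡⟨ tabulate∘lookup x ⟩
    x                                                ∎
    where
    open ≡-Reasoning
    lookup-select : ∀ j → lookup (select x (tabulate redirect)) j ≡ lookup x j
    lookup-select j = trans (lookup-map j (lookup x) (tabulate redirect))
                     (trans (cong (lookup x) (lookup∘tabulate redirect j)) (lookup-redirect x xα≡xβ j))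

  lookup-redirect-α≡β : lookup (tabulate redirect) α ≡ lookup (tabulate redirect) β
  lookup-redirect-α≡β = trans (lookup∘tabulate redirect α)
                       (trans redirect-α≡redirect-β (sym (lookup∘tabulate redirect β)))

¬→⇒×¬ : ∀ {P Q : Set} → Dec P → ¬ (P → Q) → P × ¬ Q
¬→⇒×¬ (yes p) ¬p→q = p , λ q → ¬p→q (λ _ → q)
¬→⇒×¬ (no ¬p) ¬p→q = ⊥-elim (¬p→q (λ p → ⊥-elim (¬p p)))

≺-at? : ∀ {S T : Set} {k} → DecidableEquality S → DecidableEquality T →
        (x : Vec S k) (a : Vec T k) (α β : Fin k) →
        Dec (lookup x α ≡ lookup x β → lookup a α ≡ lookup a β)
≺-at? _≟ˢ_ _≟ᵗ_ x a α β = (lookup x α ≟ˢ lookup x β) →-dec (lookup a α ≟ᵗ lookup a β)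

⊀⇒∃ : ∀ {S T : Set} {k} → DecidableEquality S → DecidableEquality T →
      (x : Vec S k) (a : Vec T k) → ¬ (x ≺ a) →
      Σ[ α ∈ Fin k ] Σ[ β ∈ Fin k ] (lookup x α ≡ lookup x β × lookup a α ≢ lookup a β)
⊀⇒∃ {k = k} _≟ˢ_ _≟ᵗ_ x a x⊀a =
  let α , ¬∀β = ¬∀⟶∃¬ k _ (λ α → all? (≺-at? _≟ˢ_ _≟ᵗ_ x a α)) x⊀a
      β , ¬imp = ¬∀⟶∃¬ k _ (≺-at? _≟ˢ_ _≟ᵗ_ x a α) ¬∀β
  in α , β , ¬→⇒×¬ (lookup x α ≟ˢ lookup x β) ¬imp

lemma4p3 : (σ : Signature) (k : ℕ) (X A : Structure σ) →
    Enhanced k X → Enhanced k A →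
    (ξ : Vec (Dom X) k → Tensor (size A) k) → IsHomTensorFree k X A ξ →
    ∀ (x : Vec (Dom X) k) (a : Vec (Dom A) k) → ¬ (x ≺ a) → proj₁ (ξ x) a ≡ 0ℚ
lemma4p3 σ .(ar σ Rₖ) X A (Rₖ , refl , Rₖ-full) _ ξ hom x a x⊀a =
  let α , β , xα≡xβ , aα≢aβ = ⊀⇒∃ _≟ᶠ_ _≟ᶠ_ x a x⊀a
      i = tabulate (redirect α β)
  in subst (λ y → proj₁ (ξ y) a ≡ 0ℚ) (select-redirect α β x xα≡xβ)
       (hom-≡0 ξ hom Rₖ (Rₖ-full x) i a (select-≢ (lookup-redirect-α≡β α β) aα≢aβ))
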